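{- As formal power series in $q$ with coefficients polynomial in $x$ (equivalently, for complex $q$ with $|q|<1$), we have \begin{align*} \sum_{i, j\geq 0}\frac{(-1)^jx^{i+j}q^{i^2+2ij+j^2}}{(q^8; q^8)_i(q^8; q^8)_j}&=\sum_{n\geq 0}\frac{x^{2n}q^{4n^2}}{(q^{16}; q^{16})_{n}},\\ \sum_{i, j\geq 0}\frac{(-1)^{\binom{i-j}{2}}x^{i+j}q^{3i^2+2ij+3j^2}}{(q^4; q^4)_i(q^4; q^4)_j}&=\sum_{n\geq 0}\frac{x^{2n}q^{8n^2}}{(q^{8}; q^{8})_{n}}. \end{align*}
   Context: $(a;q)_n=(1-a)(1-aq)\cdots(1-aq^{n-1})$ for $n\ge1$, $(a;q)_0=1$. For an integer $m$ (possibly negative), $\binom{m}{2}=m(m-1)/2$. -}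

module Defs where

open import Data.Nat as ℕ using (ℕ; zero; suc; _∸_; _≡ᵇ_; _%_; _/_)
open import Data.Nat.Divisibility using (_∣?_)
open import Data.Integer as ℤ using (ℤ; +_; ∣_∣)
open import Data.Bool using (Bool; true; false; if_then_else_)
open import Relation.Nullary.Decidable using (⌊_⌋)

-- Formal power series in q with integer coefficients: N ↦ [q^N].
Series : Set
Series = ℕ → ℤ

zeroS : Series
zeroS _ = + 0

oneS : Series
oneS zero    = + 1
oneS (suc _) = + 0

_⊕_ : Series → Series → Series
(f ⊕ g) N = f N ℤ.+ g N

_⊙_ : ℤ → Series → Series
(c ⊙ f) N = c ℤ.* f N

sumTo : {A : Set} → (A → A → A) → A → (ℕ → A) → ℕ → A
sumTo _+_ z f zero    = f zero
sumTo _+_ z f (suc k) = sumTo _+_ z f k + f (suc k)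

_⊗_ : Series → Series → Series
(f ⊗ g) N = sumTo ℤ._+_ (+ 0) (λ t → f t ℤ.* g (N ∸ t)) N

qpow : ℕ → Series
qpow e N = if e ≡ᵇ N then + 1 else + 0

-- 1/(1 - q^d) = Σ_{t ≥ 0} q^{d t}   (used with d ≥ 1)
geo : ℕ → Series
geo d N = if ⌊ d ∣? N ⌋ then + 1 else + 0

-- 1/(q^a; q^a)_n = Π_{m=1}^{n} 1/(1 - q^{a m})
invPoch : ℕ → ℕ → Series
invPoch a zero    = oneS
invPoch a (suc n) = invPoch a n ⊗ geo (a ℕ.* suc n)

signZ : ℤ → ℤ
signZ e = if (∣ e ∣ % 2) ≡ᵇ 0 then + 1 else ℤ.- (+ 1)

-- binom(m,2) = m(m-1)/2 for an integer m (m(m-1) ≥ 0 and even)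
binom2 : ℤ → ℤ
binom2 m = + (∣ m ℤ.* (m ℤ.- + 1) ∣ / 2)

-- Series in q whose coefficients are polynomials in x, recorded as
-- k ↦ (the q-series coefficient of x^k).
XSeries : Set
XSeries = ℕ → Series

-- Σ_{i,j ≥ 0} x^{i+j} T i j : coefficient of x^k collects the (finitely many)
-- pairs with i + j = k.
doubleSumX : (ℕ → ℕ → Series) → XSeries
doubleSumX T k = sumTo _⊕_ zeroS (λ i → sumTo _⊕_ zeroS
                   (λ j → if (i ℕ.+ j) ≡ᵇ k then T i j else zeroS) k) k

-- Σ_{n ≥ 0} x^{2n} T n : coefficient of x^k collects n with 2n = k.
singleSumX2 : (ℕ → Series) → XSeries
singleSumX2 T k = sumTo _⊕_ zeroS (λ n → if (2 ℕ.* n) ≡ᵇ k then T n else zeroS) k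

lhs1 : ℕ → ℕ → Series
lhs1 i j = signZ (+ j) ⊙ ((qpow (i ℕ.* i ℕ.+ 2 ℕ.* i ℕ.* j ℕ.+ j ℕ.* j)
                          ⊗ invPoch 8 i) ⊗ invPoch 8 j)

rhs1 : ℕ → Series
rhs1 n = qpow (4 ℕ.* n ℕ.* n) ⊗ invPoch 16 n

lhs2 : ℕ → ℕ → Series
lhs2 i j = signZ (binom2 (+ i ℤ.- + j))
             ⊙ ((qpow (3 ℕ.* i ℕ.* i ℕ.+ 2 ℕ.* i ℕ.* j ℕ.+ 3 ℕ.* j ℕ.* j)
                 ⊗ invPoch 4 i) ⊗ invPoch 4 j)

rhs2 : ℕ → Series
rhs2 n = qpow (8 ℕ.* n ℕ.* n) ⊗ invPoch 8 n

-- Write D k for the coefficient of x^k on the left, so D k = Σ_{i+j=k} w i j P i P j with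
-- P i = 1/(q^a;q^a)_i, where (a, b) = (8, 4) for the first identity and (4, 8) for the second.
-- Since (1 - q^{a(i+1)}) P (i+1) = P i and 1 - q^{a(i+j)} = (1 - q^{ai}) + q^{ai} (1 - q^{aj}),
--   (1 - q^{a(k+1)}) D (k+1) = Σ_{i+j=k} (w (i+1) j + q^{ai} w i (j+1)) P i P j.
-- The weights have a symmetry, w i (j+1) = - w (i+1) j in the first identity and
-- q^{4i} w i (j+1) = - q^{4j} w (i+1) j in the second (the sign (-1)^binom(d,2) flips between
-- d - 1 and d + 1), that turns this into the two-step recurrence
-- (1 - q^{a(k+2)}) D (k+2) = q^{b(k+1)} D k, with D 0 = 1 and D 1 = 0.  The coefficient
-- q^{bn²}/(q^{2a};q^{2a})_n of x^{2n} on the right obeys the same recurrence, and 1 - q^m is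
-- invertible in ℤ[[q]] for m ≥ 1, so the two sides agree.
module Submission where

open import Defs
open import Data.Nat using (ℕ)
open import Data.Product using (_×_)
open import Relation.Binary.PropositionalEquality using (_≡_)

open import Algebra.Bundles using (CommutativeMonoid; Semiring; CommutativeRing)
import Algebra.Construct.Pointwise as Pointwise
import Algebra.Definitions.RawSemiring as RawSemiringDefinitions
open import Algebra.Structures using (IsCommutativeRing)
open import Data.Bool using (true; false; if_then_else_)
open import Data.Integer as ℤ using (ℤ; +_; -[1+_])
import Data.Integer.Properties as ℤ
open import Data.Integer.Tactic.RingSolver using (solve-∀)
open import Data.Nat as ℕ using (zero; suc; _∸_; _≤_; z≤n; s≤s; NonZero)
open import Data.Nat.Divisibility using (_∣_; _∣?_; ∣-refl; ∣⇒≤; ∣m+n∣m⇒∣n; ∣m∸n∣n⇒∣m)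
open import Data.Nat.DivMod using (m*n/n≡m)
import Data.Nat.Properties as ℕ
open import Data.Nat.Tactic.RingSolver using () renaming (solve-∀ to ℕ-solve-∀)
open import Data.Product using (_,_; proj₁; proj₂; ∃-syntax)
open import Data.Sum using (_⊎_; inj₁; inj₂)
open import Function using (_∘_)
open import Level using (0ℓ)
import Relation.Binary.PropositionalEquality as ≡
open ≡ using (_≢_; _≗_)
open import Relation.Nullary using (¬_; yes; no; contradiction)
open import Relation.Nullary.Decidable using (dec-true; dec-false)
open import Relation.Nullary.Reflects using (ofʸ; ofⁿ)

-- Finite sums

module SumToProperties {ℓ} (M : CommutativeMonoid 0ℓ ℓ) where
  open CommutativeMonoid M
  open import Algebra.Properties.CommutativeSemigroup commutativeSemigroup using (interchange)

  sumTo-cong : ∀ {f g} k → (∀ i → i ≤ k → f i ≈ g i) → sumTo _∙_ ε f k ≈ sumTo _∙_ ε g k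
  sumTo-cong zero    f≈g = f≈g 0 z≤n
  sumTo-cong (suc k) f≈g =
    ∙-cong (sumTo-cong k (λ i i≤k → f≈g i (ℕ.m≤n⇒m≤1+n i≤k))) (f≈g (suc k) ℕ.≤-refl)

  sumTo-distrib : ∀ f g k →
    sumTo _∙_ ε (λ i → f i ∙ g i) k ≈ sumTo _∙_ ε f k ∙ sumTo _∙_ ε g k
  sumTo-distrib f g zero    = refl
  sumTo-distrib f g (suc k) =
    trans (∙-congʳ (sumTo-distrib f g k)) (interchange _ _ (f (suc k)) (g (suc k)))

  sumTo-head : ∀ f k → sumTo _∙_ ε f (suc k) ≈ f 0 ∙ sumTo _∙_ ε (f ∘ suc) k
  sumTo-head f zero    = refl
  sumTo-head f (suc k) = trans (∙-congʳ (sumTo-head f k)) (assoc _ _ _)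

  sumTo-zero : ∀ f k → (∀ i → i ≤ k → f i ≈ ε) → sumTo _∙_ ε f k ≈ ε
  sumTo-zero f zero    f≈ε = f≈ε 0 z≤n
  sumTo-zero f (suc k) f≈ε = trans
    (∙-cong (sumTo-zero f k (λ i i≤k → f≈ε i (ℕ.m≤n⇒m≤1+n i≤k))) (f≈ε (suc k) ℕ.≤-refl))
    (identityˡ ε)

  sumTo-single : ∀ f k j → j ≤ k → (∀ i → i ≤ k → i ≢ j → f i ≈ ε) → sumTo _∙_ ε f k ≈ f j
  sumTo-single f zero    .zero z≤n   _   = refl
  sumTo-single f (suc k) j     j≤1+k f≈ε with j ℕ.≟ suc k
  ... | yes ≡.refl = trans
    (∙-congʳ (sumTo-zero f k (λ i i≤k → f≈ε i (ℕ.m≤n⇒m≤1+n i≤k) (ℕ.<⇒≢ (s≤s i≤k)))))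
    (identityˡ (f (suc k)))
  ... | no  j≢1+k = trans
    (∙-cong (sumTo-single f k j (ℕ.s≤s⁻¹ (ℕ.≤∧≢⇒< j≤1+k j≢1+k)) (λ i i≤k → f≈ε i (ℕ.m≤n⇒m≤1+n i≤k)))
            (f≈ε (suc k) ℕ.≤-refl (≡.≢-sym j≢1+k)))
    (identityʳ (f j))

module _ {ℓ} (R : Semiring 0ℓ ℓ) where
  open Semiring R

  *-distribˡ-sumTo : ∀ y f k → y * sumTo _+_ 0# f k ≈ sumTo _+_ 0# (λ i → y * f i) k
  *-distribˡ-sumTo y f zero    = refl
  *-distribˡ-sumTo y f (suc k) =
    trans (distribˡ y (sumTo _+_ 0# f k) (f (suc k))) (+-congʳ (*-distribˡ-sumTo y f k))

-- Antidiagonal sums in a commutative ring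

module CommutativeRingProperties {c ℓ} (R : CommutativeRing c ℓ) where
  open CommutativeRing R
  open import Algebra.Properties.Ring ring using (x[y-z]≈xy-xz)
  open import Relation.Binary.Reasoning.Setoid setoid

  1-xy≈[1-x]+x[1-y] : ∀ a b → 1# - a * b ≈ (1# - a) + a * (1# - b)
  1-xy≈[1-x]+x[1-y] a b = sym (begin
    (1# - a) + a * (1# - b)   ≈⟨ +-congˡ (trans (x[y-z]≈xy-xz a 1# b) (+-congʳ (*-identityʳ a))) ⟩
    (1# - a) + (a - a * b)    ≈⟨ +-assoc 1# (- a) (a - a * b) ⟩
    1# + (- a + (a - a * b))  ≈⟨ +-congˡ (sym (+-assoc (- a) a (- (a * b)))) ⟩
    1# + ((- a + a) - a * b)  ≈⟨ +-congˡ (+-congʳ (-‿inverseˡ a)) ⟩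
    1# + (0# - a * b)         ≈⟨ +-congˡ (+-identityˡ (- (a * b))) ⟩
    1# - a * b                ∎)

  x-yx≈x[1-y] : ∀ a b → a - b * a ≈ a * (1# - b)
  x-yx≈x[1-y] a b = sym (begin
    a * (1# - b)    ≈⟨ x[y-z]≈xy-xz a 1# b ⟩
    a * 1# - a * b  ≈⟨ +-cong (*-identityʳ a) (-‿cong (*-comm a b)) ⟩
    a - b * a       ∎)

module _ {ℓ} (R : CommutativeRing 0ℓ ℓ) where
  open CommutativeRing R
  open RawSemiringDefinitions (Semiring.rawSemiring semiring) using (_^_)

  PochhammerRecurrence : Carrier → (ℕ → Carrier) → Set ℓ
  PochhammerRecurrence t P = ∀ i → (1# - t ^ suc i) * P (suc i) ≈ P i

module DiagonalSums {ℓ} (R : CommutativeRing 0ℓ ℓ) (t : CommutativeRing.Carrier R)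
  (P : ℕ → CommutativeRing.Carrier R) (P-rec : PochhammerRecurrence R t P) where

  open CommutativeRing R
  open RawSemiringDefinitions (Semiring.rawSemiring semiring) using (_^_)
  open import Algebra.Properties.CommutativeSemigroup *-commutativeSemigroup using (xy∙z≈xz∙y)
  open import Algebra.Properties.Ring ring using (-‿involutive; -‿distribʳ-*)
  open import Algebra.Properties.Semiring.Exp semiring using (^-homo-*; ^-congʳ)
  open import Relation.Binary.Reasoning.Setoid setoid
  open SumToProperties +-commutativeMonoid
  open CommutativeRingProperties R

  diagSum : (ℕ → ℕ → Carrier) → ℕ → Carrier
  diagSum w k = sumTo _+_ 0# (λ i → w i (k ∸ i) * P i * P (k ∸ i)) k

  diagSum-cong : ∀ {w v} k → (∀ i j → i ℕ.+ j ≡ k → w i j ≈ v i j) → diagSum w k ≈ diagSum v k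
  diagSum-cong k w≈v =
    sumTo-cong k (λ i i≤k → *-congʳ (*-congʳ (w≈v i (k ∸ i) (ℕ.m+[n∸m]≡n i≤k))))

  diagSum-+ : ∀ (w v : ℕ → ℕ → Carrier) k →
              diagSum (λ i j → w i j + v i j) k ≈ diagSum w k + diagSum v k
  diagSum-+ w v k = trans
    (sumTo-cong k (λ i _ → trans (*-congʳ (distribʳ (P i) _ _)) (distribʳ (P (k ∸ i)) _ _)))
    (sumTo-distrib _ _ k)

  *-distribˡ-diagSum : ∀ y (w : ℕ → ℕ → Carrier) k → y * diagSum w k ≈ diagSum (λ i j → y * w i j) k
  *-distribˡ-diagSum y w k = trans (*-distribˡ-sumTo semiring y _ k) (sumTo-cong k (λ i _ →
    sym (trans (*-assoc (y * w i (k ∸ i)) (P i) (P (k ∸ i)))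
        (trans (*-assoc y (w i (k ∸ i)) (P i * P (k ∸ i)))
               (*-congˡ (sym (*-assoc (w i (k ∸ i)) (P i) (P (k ∸ i)))))))))

  private
    vanishing-term : ∀ v a b m → m ≡ 0 → v * (1# - t ^ m) * a * b ≈ 0#
    vanishing-term v a b .0 ≡.refl = begin
      v * (1# - 1#) * a * b  ≈⟨ *-congʳ (*-congʳ (*-congˡ (-‿inverseʳ 1#))) ⟩
      v * 0# * a * b         ≈⟨ *-congʳ (trans (*-congʳ (zeroʳ v)) (zeroˡ a)) ⟩
      0# * b                 ≈⟨ zeroˡ b ⟩
      0#                     ∎

  diagSum-absorbˡ : ∀ (w : ℕ → ℕ → Carrier) k →
    diagSum (λ i j → w i j * (1# - t ^ i)) (suc k) ≈ diagSum (λ i j → w (suc i) j) k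
  diagSum-absorbˡ w k = begin
    diagSum (λ i j → w i j * (1# - t ^ i)) (suc k)
      ≈⟨ sumTo-head (λ i → w i (suc k ∸ i) * (1# - t ^ i) * P i * P (suc k ∸ i)) k ⟩
    w 0 (suc k) * (1# - t ^ 0) * P 0 * P (suc k) +
    sumTo _+_ 0# (λ i → w (suc i) (k ∸ i) * (1# - t ^ suc i) * P (suc i) * P (k ∸ i)) k
      ≈⟨ +-cong (vanishing-term (w 0 (suc k)) (P 0) (P (suc k)) 0 ≡.refl)
                (sumTo-cong k (λ i _ → *-congʳ (absorb i (k ∸ i)))) ⟩
    0# + diagSum (λ i j → w (suc i) j) k
      ≈⟨ +-identityˡ _ ⟩
    diagSum (λ i j → w (suc i) j) k ∎
    where
    absorb : ∀ i j → w (suc i) j * (1# - t ^ suc i) * P (suc i) ≈ w (suc i) j * P i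
    absorb i j = trans (*-assoc _ _ _) (*-congˡ (P-rec i))

  diagSum-absorbʳ : ∀ (w : ℕ → ℕ → Carrier) k →
    diagSum (λ i j → w i j * (1# - t ^ j)) (suc k) ≈ diagSum (λ i j → w i (suc j)) k
  diagSum-absorbʳ w k = begin
    diagSum (λ i j → w i j * (1# - t ^ j)) (suc k)
      ≈⟨ +-cong (sumTo-cong k (λ i i≤k → absorb i (suc k ∸ i) (k ∸ i) (ℕ.+-∸-assoc 1 i≤k)))
                (vanishing-term (w (suc k) (k ∸ k)) (P (suc k)) (P (k ∸ k)) (k ∸ k) (ℕ.n∸n≡0 k)) ⟩
    diagSum (λ i j → w i (suc j)) k + 0#
      ≈⟨ +-identityʳ _ ⟩
    diagSum (λ i j → w i (suc j)) k ∎
    where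
    absorb : ∀ i m j → m ≡ suc j → w i m * (1# - t ^ m) * P i * P m ≈ w i (suc j) * P i * P j
    absorb i .(suc j) j ≡.refl = begin
      w i (suc j) * (1# - t ^ suc j) * P i * P (suc j)    ≈⟨ *-congʳ (xy∙z≈xz∙y _ _ _) ⟩
      w i (suc j) * P i * (1# - t ^ suc j) * P (suc j)    ≈⟨ *-assoc _ _ _ ⟩
      w i (suc j) * P i * ((1# - t ^ suc j) * P (suc j))  ≈⟨ *-congˡ (P-rec j) ⟩
      w i (suc j) * P i * P j                             ∎

  diagSum-step : ∀ (w : ℕ → ℕ → Carrier) k → (1# - t ^ suc k) * diagSum w (suc k) ≈
                 diagSum (λ i j → w (suc i) j + t ^ i * w i (suc j)) k
  diagSum-step w k = begin
    (1# - t ^ suc k) * diagSum w (suc k)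
      ≈⟨ *-distribˡ-diagSum _ w (suc k) ⟩
    diagSum (λ i j → (1# - t ^ suc k) * w i j) (suc k)
      ≈⟨ diagSum-cong (suc k) split ⟩
    diagSum (λ i j → w i j * (1# - t ^ i) + t ^ i * w i j * (1# - t ^ j)) (suc k)
      ≈⟨ diagSum-+ (λ i j → w i j * (1# - t ^ i)) (λ i j → t ^ i * w i j * (1# - t ^ j)) (suc k) ⟩
    diagSum (λ i j → w i j * (1# - t ^ i)) (suc k) +
    diagSum (λ i j → t ^ i * w i j * (1# - t ^ j)) (suc k)
      ≈⟨ +-cong (diagSum-absorbˡ w k) (diagSum-absorbʳ (λ i j → t ^ i * w i j) k) ⟩
    diagSum (λ i j → w (suc i) j) k + diagSum (λ i j → t ^ i * w i (suc j)) k
      ≈⟨ diagSum-+ (λ i j → w (suc i) j) (λ i j → t ^ i * w i (suc j)) k ⟨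
    diagSum (λ i j → w (suc i) j + t ^ i * w i (suc j)) k ∎
    where
    split : ∀ i j → i ℕ.+ j ≡ suc k →
            (1# - t ^ suc k) * w i j ≈ w i j * (1# - t ^ i) + t ^ i * w i j * (1# - t ^ j)
    split i j i+j≡1+k = begin
      (1# - t ^ suc k) * w i j
        ≈⟨ *-congʳ (+-congˡ (-‿cong (trans (^-congʳ t (≡.sym i+j≡1+k)) (^-homo-* t i j)))) ⟩
      (1# - t ^ i * t ^ j) * w i j
        ≈⟨ *-congʳ (1-xy≈[1-x]+x[1-y] (t ^ i) (t ^ j)) ⟩
      ((1# - t ^ i) + t ^ i * (1# - t ^ j)) * w i j
        ≈⟨ distribʳ (w i j) _ _ ⟩
      (1# - t ^ i) * w i j + t ^ i * (1# - t ^ j) * w i j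
        ≈⟨ +-cong (*-comm _ _) (xy∙z≈xz∙y _ _ _) ⟩
      w i j * (1# - t ^ i) + t ^ i * w i j * (1# - t ^ j) ∎

  diagSum-skew-recurrence : ∀ (w : ℕ → ℕ → Carrier) → (∀ i j → w i (suc j) ≈ - w (suc i) j) →
    ∀ y k → (∀ i j → i ℕ.+ j ≡ k → w (suc i) (suc j) ≈ - (y * w i j)) →
    (1# - t ^ (2 ℕ.+ k)) * diagSum w (2 ℕ.+ k) ≈ y * diagSum w k
  diagSum-skew-recurrence w skew y k diagonal = begin
    (1# - t ^ (2 ℕ.+ k)) * diagSum w (2 ℕ.+ k)
      ≈⟨ diagSum-step w (suc k) ⟩
    diagSum (λ i j → w (suc i) j + t ^ i * w i (suc j)) (suc k)
      ≈⟨ diagSum-cong (suc k) (λ i j _ → factor i j) ⟩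
    diagSum (λ i j → w (suc i) j * (1# - t ^ i)) (suc k)
      ≈⟨ diagSum-absorbˡ (λ i j → w (suc i) j) k ⟩
    diagSum (λ i j → w (2 ℕ.+ i) j) k
      ≈⟨ diagSum-cong k shift ⟩
    diagSum (λ i j → y * w i j) k
      ≈⟨ *-distribˡ-diagSum y w k ⟨
    y * diagSum w k ∎
    where
    factor : ∀ i j → w (suc i) j + t ^ i * w i (suc j) ≈ w (suc i) j * (1# - t ^ i)
    factor i j = trans (+-congˡ (trans (*-congˡ (skew i j)) (sym (-‿distribʳ-* _ _))))
                       (x-yx≈x[1-y] (w (suc i) j) (t ^ i))
    shift : ∀ i j → i ℕ.+ j ≡ k → w (2 ℕ.+ i) j ≈ y * w i j
    shift i j i+j≡k = begin
      w (2 ℕ.+ i) j        ≈⟨ -‿involutive _ ⟨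
      - - w (2 ℕ.+ i) j    ≈⟨ -‿cong (skew (suc i) j) ⟨
      - w (suc i) (suc j)  ≈⟨ -‿cong (diagonal i j i+j≡k) ⟩
      - - (y * w i j)      ≈⟨ -‿involutive _ ⟩
      y * w i j            ∎

  diagSum-twisted-recurrence : ∀ (w : ℕ → ℕ → Carrier) →
    (∀ i j → t ^ i * w i (suc j) ≈ - (t ^ j * w (suc i) j)) →
    ∀ y k → (∀ i j → i ℕ.+ j ≡ k → w (suc i) (suc j) ≈ y * w i j) →
    (1# - t ^ (2 ℕ.+ k)) * diagSum w (2 ℕ.+ k) ≈ y * diagSum w k
  diagSum-twisted-recurrence w twisted y k diagonal = begin
    (1# - t ^ (2 ℕ.+ k)) * diagSum w (2 ℕ.+ k)
      ≈⟨ diagSum-step w (suc k) ⟩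
    diagSum (λ i j → w (suc i) j + t ^ i * w i (suc j)) (suc k)
      ≈⟨ diagSum-cong (suc k) (λ i j _ → factor i j) ⟩
    diagSum (λ i j → w (suc i) j * (1# - t ^ j)) (suc k)
      ≈⟨ diagSum-absorbʳ (λ i j → w (suc i) j) k ⟩
    diagSum (λ i j → w (suc i) (suc j)) k
      ≈⟨ diagSum-cong k diagonal ⟩
    diagSum (λ i j → y * w i j) k
      ≈⟨ *-distribˡ-diagSum y w k ⟨
    y * diagSum w k ∎
    where
    factor : ∀ i j → w (suc i) j + t ^ i * w i (suc j) ≈ w (suc i) j * (1# - t ^ j)
    factor i j = trans (+-congˡ (twisted i j)) (x-yx≈x[1-y] (w (suc i) j) (t ^ j))

module _ {a ℓ} (R : Semiring a ℓ) where
  open Semiring R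

  module _ (v c L M : ℕ → Carrier) (cancel : ∀ k {y z} → v k * y ≈ v k * z → y ≈ z)
           (L-rec : ∀ k → v k * L (2 ℕ.+ k) ≈ c k * L k)
           (M-rec : ∀ n → v (2 ℕ.* n) * M (suc n) ≈ c (2 ℕ.* n) * M n)
           (L₀ : L 0 ≈ M 0) (L₁ : L 1 ≈ 0#) where

    even-odd-from-recurrence : ∀ n → L (2 ℕ.* n) ≈ M n × L (suc (2 ℕ.* n)) ≈ 0#
    even-odd-from-recurrence zero = L₀ , L₁
    even-odd-from-recurrence (suc n) with even-odd-from-recurrence n
    ... | L-even , L-odd rewrite ℕ.*-suc 2 n =
        cancel (2 ℕ.* n) (trans (L-rec (2 ℕ.* n)) (trans (*-congˡ L-even) (sym (M-rec n))))
      , cancel (suc (2 ℕ.* n))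
          (trans (L-rec (suc (2 ℕ.* n))) (trans (*-congˡ L-odd) (trans (zeroʳ _) (sym (zeroʳ _)))))

-- Power series

module _ where
  open SumToProperties ℤ.+-0-commutativeMonoid
  open ≡ using (refl; sym; trans; cong; cong₂)
  open ≡.≡-Reasoning
  open import Data.Integer using (_+_; _*_)

  ⊗-cong : ∀ {f f′ g g′} → f ≗ f′ → g ≗ g′ → (f ⊗ g) ≗ (f′ ⊗ g′)
  ⊗-cong f≗f′ g≗g′ N = sumTo-cong N (λ t _ → cong₂ _*_ (f≗f′ t) (g≗g′ (N ∸ t)))

  ⊗-peelˡ : ∀ f g → ((f ⊗ g) ∘ suc) ≗ ((f 0 ⊙ (g ∘ suc)) ⊕ ((f ∘ suc) ⊗ g))
  ⊗-peelˡ f g N = sumTo-head (λ t → f t * g (suc N ∸ t)) N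

  ⊗-peelʳ : ∀ f g N → (f ⊗ g) (suc N) ≡ (f ⊗ (g ∘ suc)) N + f (suc N) * g 0
  ⊗-peelʳ f g N = cong₂ _+_
    (sumTo-cong N (λ t t≤N → cong (λ m → f t * g m) (ℕ.+-∸-assoc 1 t≤N)))
    (cong (λ m → f (suc N) * g m) (ℕ.n∸n≡0 N))

  ⊗-comm : ∀ f g → (f ⊗ g) ≗ (g ⊗ f)
  ⊗-comm f g zero    = ℤ.*-comm (f 0) (g 0)
  ⊗-comm f g (suc N) = begin
    (f ⊗ g) (suc N)                      ≡⟨ ⊗-peelˡ f g N ⟩
    f 0 * g (suc N) + ((f ∘ suc) ⊗ g) N  ≡⟨ cong₂ _+_ (ℤ.*-comm (f 0) (g (suc N))) (⊗-comm (f ∘ suc) g N) ⟩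
    g (suc N) * f 0 + (g ⊗ (f ∘ suc)) N  ≡⟨ ℤ.+-comm (g (suc N) * f 0) _ ⟩
    (g ⊗ (f ∘ suc)) N + g (suc N) * f 0  ≡⟨ ⊗-peelʳ g f N ⟨
    (g ⊗ f) (suc N)                      ∎

  ⊗-identityˡ : ∀ f → (oneS ⊗ f) ≗ f
  ⊗-identityˡ f N = trans (sumTo-single _ N 0 z≤n only-t≡0) (ℤ.*-identityˡ (f N))
    where
    only-t≡0 : ∀ t → t ≤ N → t ≢ 0 → oneS t * f (N ∸ t) ≡ + 0
    only-t≡0 zero    _ 0≢0 = contradiction refl 0≢0
    only-t≡0 (suc t) _ _   = refl

  ⊗-distribʳ-⊕ : ∀ h f g → ((f ⊕ g) ⊗ h) ≗ ((f ⊗ h) ⊕ (g ⊗ h))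
  ⊗-distribʳ-⊕ h f g N =
    trans (sumTo-cong N (λ t _ → ℤ.*-distribʳ-+ (h (N ∸ t)) (f t) (g t))) (sumTo-distrib _ _ N)

  ⊙-⊗-assoc : ∀ c f g → ((c ⊙ f) ⊗ g) ≗ (c ⊙ (f ⊗ g))
  ⊙-⊗-assoc c f g N = trans (sumTo-cong N (λ t _ → ℤ.*-assoc c (f t) (g (N ∸ t))))
                            (sym (*-distribˡ-sumTo ℤ.+-*-semiring c _ N))

  ⊗-assoc : ∀ f g h → ((f ⊗ g) ⊗ h) ≗ (f ⊗ (g ⊗ h))
  ⊗-assoc f g h zero    = ℤ.*-assoc (f 0) (g 0) (h 0)
  ⊗-assoc f g h (suc N) = begin
    ((f ⊗ g) ⊗ h) (suc N)
      ≡⟨ ⊗-peelˡ (f ⊗ g) h N ⟩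
    f 0 * g 0 * h (suc N) + (((f ⊗ g) ∘ suc) ⊗ h) N
      ≡⟨ cong (λ z → f 0 * g 0 * h (suc N) + z) (⊗-cong {g = h} (⊗-peelˡ f g) (λ _ → refl) N) ⟩
    f 0 * g 0 * h (suc N) + (((f 0 ⊙ (g ∘ suc)) ⊕ ((f ∘ suc) ⊗ g)) ⊗ h) N
      ≡⟨ cong (λ z → f 0 * g 0 * h (suc N) + z)
              (trans (⊗-distribʳ-⊕ h (f 0 ⊙ (g ∘ suc)) ((f ∘ suc) ⊗ g) N)
                     (cong₂ _+_ (⊙-⊗-assoc (f 0) (g ∘ suc) h N) (⊗-assoc (f ∘ suc) g h N))) ⟩
    f 0 * g 0 * h (suc N) + (f 0 * ((g ∘ suc) ⊗ h) N + ((f ∘ suc) ⊗ (g ⊗ h)) N)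
      ≡⟨ factor (f 0) (g 0) (h (suc N)) _ _ ⟩
    f 0 * (g 0 * h (suc N) + ((g ∘ suc) ⊗ h) N) + ((f ∘ suc) ⊗ (g ⊗ h)) N
      ≡⟨ cong (λ z → f 0 * z + ((f ∘ suc) ⊗ (g ⊗ h)) N) (⊗-peelˡ g h N) ⟨
    f 0 * (g ⊗ h) (suc N) + ((f ∘ suc) ⊗ (g ⊗ h)) N
      ≡⟨ ⊗-peelˡ f (g ⊗ h) N ⟨
    (f ⊗ (g ⊗ h)) (suc N) ∎
    where
    factor : ∀ a b c X Y → a * b * c + (a * X + Y) ≡ a * (b * c + X) + Y
    factor = solve-∀

infixl 6 _+ₛ_
infixl 7 _*ₛ_
infix  8 -ₛ_

-- Opaque copies of _⊕_, _⊗_ and negation serve as the ring operations: the unifier η-expands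
-- a transparent f ⊗ g into its coefficient sums, from which implicit arguments cannot be inferred.
opaque
  _+ₛ_ : Series → Series → Series
  _+ₛ_ = _⊕_

  _*ₛ_ : Series → Series → Series
  _*ₛ_ = _⊗_

  -ₛ_ : Series → Series
  (-ₛ f) N = ℤ.- f N

opaque
  unfolding _+ₛ_ _*ₛ_ -ₛ_

  ⊕≗+ₛ : ∀ f g → (f ⊕ g) ≗ (f +ₛ g)
  ⊕≗+ₛ f g N = ≡.refl

  ⊗≗*ₛ : ∀ f g → (f ⊗ g) ≗ (f *ₛ g)
  ⊗≗*ₛ f g N = ≡.refl

  -ₛ-coeff : ∀ f N → (-ₛ f) N ≡ ℤ.- f N
  -ₛ-coeff f N = ≡.refl

  series-isCommutativeRing : IsCommutativeRing _≗_ _+ₛ_ _*ₛ_ -ₛ_ zeroS oneS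
  series-isCommutativeRing = record
    { isRing = record
      { +-isAbelianGroup = Pointwise.isAbelianGroup ℕ ℤ.+-0-isAbelianGroup
      ; *-cong = ⊗-cong
      ; *-assoc = ⊗-assoc
      ; *-identity = comm∧idˡ⇒id ⊗-comm {oneS} ⊗-identityˡ
      ; distrib = comm∧distrʳ⇒distr (λ f≗f′ g≗g′ N → ≡.cong₂ ℤ._+_ (f≗f′ N) (g≗g′ N)) ⊗-comm ⊗-distribʳ-⊕
      }
    ; *-comm = ⊗-comm
    }
    where open import Algebra.Consequences.Setoid (ℕ ≡.→-setoid ℤ)

seriesRing : CommutativeRing 0ℓ 0ℓ
seriesRing = record { isCommutativeRing = series-isCommutativeRing }

shift : ℕ → Series → Series
shift e f N = if N ℕ.<ᵇ e then + 0 else f (N ∸ e)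

monomial : ℤ → ℕ → Series
monomial c E = c ⊙ qpow E

module _ where
  open ≡ using (refl; sym; trans)

  qpow-0 : qpow 0 ≗ oneS
  qpow-0 zero    = refl
  qpow-0 (suc _) = refl

  qpow-⊗ : ∀ e f → (qpow e ⊗ f) ≗ shift e f
  qpow-⊗ zero    f N       = trans (⊗-cong {g = f} qpow-0 (λ _ → refl) N) (⊗-identityˡ f N)
  qpow-⊗ (suc e) f zero    = refl
  qpow-⊗ (suc e) f (suc N) =
    trans (⊗-peelˡ (qpow (suc e)) f N) (trans (ℤ.+-identityˡ _) (qpow-⊗ e f N))

  shift-qpow : ∀ a b → shift a (qpow b) ≗ qpow (a ℕ.+ b)
  shift-qpow zero    b N       = refl
  shift-qpow (suc a) b zero    = refl
  shift-qpow (suc a) b (suc N) = shift-qpow a b N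

  qpow-⊗-qpow : ∀ a b → (qpow a ⊗ qpow b) ≗ qpow (a ℕ.+ b)
  qpow-⊗-qpow a b N = trans (qpow-⊗ a (qpow b) N) (shift-qpow a b N)

  geo-cong : ∀ d {M N} → (d ∣ M → d ∣ N) → (d ∣ N → d ∣ M) → geo d M ≡ geo d N
  geo-cong d {M} {N} to from with d ∣? M | d ∣? N
  ... | yes _   | yes _   = refl
  ... | no  _   | no  _   = refl
  ... | yes d∣M | no  d∤N = contradiction (to d∣M) d∤N
  ... | no  d∤M | yes d∣N = contradiction (from d∣N) d∤M

  geo-∤ : ∀ d {N} → ¬ d ∣ N → geo d N ≡ + 0
  geo-∤ d {N} d∤N with d ∣? N
  ... | yes d∣N = contradiction d∣N d∤N
  ... | no  _   = refl

  geo-unfold : ∀ d .{{_ : NonZero d}} → geo d ≗ (oneS ⊕ shift d (geo d))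
  geo-unfold (suc d) zero    = refl
  geo-unfold (suc d) (suc N) with N ℕ.<ᵇ d | ℕ.<ᵇ-reflects-< N d
  ... | true  | ofʸ N<d = geo-∤ (suc d) (λ d+1∣N+1 → ℕ.<⇒≱ N<d (ℕ.s≤s⁻¹ (∣⇒≤ d+1∣N+1)))
  ... | false | ofⁿ N≮d = trans (geo-cong (suc d) to from) (sym (ℤ.+-identityˡ _))
    where
    d+1≤N+1 : suc d ≤ suc N
    d+1≤N+1 = s≤s (ℕ.≮⇒≥ N≮d)
    to : suc d ∣ suc N → suc d ∣ N ∸ d
    to d+1∣N+1 = ∣m+n∣m⇒∣n (≡.subst (suc d ∣_) (sym (ℕ.m+[n∸m]≡n d+1≤N+1)) d+1∣N+1) ∣-refl
    from : suc d ∣ N ∸ d → suc d ∣ suc N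
    from d+1∣N-d = ∣m∸n∣n⇒∣m (suc d) d+1≤N+1 d+1∣N-d ∣-refl

module _ where
  open CommutativeRing seriesRing
  open RawSemiringDefinitions (Semiring.rawSemiring semiring) using (_^_)
  open import Algebra.Properties.Monoid *-monoid using (cancelˡ; cancelʳ)
  open import Relation.Binary.Reasoning.Setoid setoid
  open CommutativeRingProperties seriesRing using (x-yx≈x[1-y])

  qpow-*-qpow : ∀ a b → qpow a * qpow b ≈ qpow (a ℕ.+ b)
  qpow-*-qpow a b = trans (sym (⊗≗*ₛ (qpow a) (qpow b))) (qpow-⊗-qpow a b)

  qpow-^ : ∀ a m → qpow a ^ m ≈ qpow (a ℕ.* m)
  qpow-^ a zero    = sym (trans (reflexive (≡.cong qpow (ℕ.*-zeroʳ a))) qpow-0)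
  qpow-^ a (suc m) = begin
    qpow a * qpow a ^ m      ≈⟨ *-congˡ (qpow-^ a m) ⟩
    qpow a * qpow (a ℕ.* m)  ≈⟨ qpow-*-qpow a (a ℕ.* m) ⟩
    qpow (a ℕ.+ a ℕ.* m)     ≈⟨ reflexive (≡.cong qpow (ℕ.*-suc a m)) ⟨
    qpow (a ℕ.* suc m)       ∎

  geo-inverse : ∀ d .{{_ : NonZero d}} → geo d * (1# - qpow d) ≈ 1#
  geo-inverse d = begin
    geo d * (1# - qpow d)                     ≈⟨ x-yx≈x[1-y] (geo d) (qpow d) ⟨
    geo d - qpow d * geo d                    ≈⟨ +-cong (trans (geo-unfold d) (⊕≗+ₛ _ _))
                                                        (-‿cong (trans (sym (⊗≗*ₛ _ _)) (qpow-⊗ d (geo d)))) ⟩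
    (1# + shift d (geo d)) - shift d (geo d)  ≈⟨ +-assoc 1# _ _ ⟩
    1# + (shift d (geo d) - shift d (geo d))  ≈⟨ +-congˡ (-‿inverseʳ _) ⟩
    1# + 0#                                   ≈⟨ +-identityʳ 1# ⟩
    1#                                        ∎

  1-qpow-cancel : ∀ d .{{_ : NonZero d}} {f g} → (1# - qpow d) * f ≈ (1# - qpow d) * g → f ≈ g
  1-qpow-cancel d {f} {g} eq = begin
    f                            ≈⟨ cancelˡ (geo-inverse d) f ⟨
    geo d * ((1# - qpow d) * f)  ≈⟨ *-congˡ eq ⟩
    geo d * ((1# - qpow d) * g)  ≈⟨ cancelˡ (geo-inverse d) g ⟩
    g                            ∎

  invPoch-rec : ∀ a .{{_ : NonZero a}} n →
                (1# - qpow (a ℕ.* suc n)) * invPoch a (suc n) ≈ invPoch a n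
  invPoch-rec a n = begin
    (1# - qpow d) * invPoch a (suc n)      ≈⟨ *-congˡ (⊗≗*ₛ (invPoch a n) (geo d)) ⟩
    (1# - qpow d) * (invPoch a n * geo d)  ≈⟨ *-comm _ _ ⟩
    invPoch a n * geo d * (1# - qpow d)    ≈⟨ cancelʳ (geo-inverse d {{ℕ.m*n≢0 a (suc n)}}) (invPoch a n) ⟩
    invPoch a n                            ∎
    where
    d : ℕ
    d = a ℕ.* suc n

  monomial-neg : ∀ c E → monomial (ℤ.- c) E ≈ - monomial c E
  monomial-neg c E N =
    ≡.trans (≡.sym (ℤ.neg-distribˡ-* c (qpow E N))) (≡.sym (-ₛ-coeff (monomial c E) N))

  qpow-*-monomial : ∀ A c E → qpow A * monomial c E ≈ monomial c (A ℕ.+ E)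
  qpow-*-monomial A c E = begin
    qpow A * (c ⊙ qpow E)  ≈⟨ *-comm (qpow A) _ ⟩
    (c ⊙ qpow E) * qpow A  ≈⟨ ⊗≗*ₛ (c ⊙ qpow E) (qpow A) ⟨
    (c ⊙ qpow E) ⊗ qpow A  ≈⟨ ⊙-⊗-assoc c (qpow E) (qpow A) ⟩
    c ⊙ (qpow E ⊗ qpow A)  ≈⟨ (λ N → ≡.cong (c ℤ.*_) (≡.trans (⊗-comm (qpow E) (qpow A) N)
                                                             (qpow-⊗-qpow A E N))) ⟩
    c ⊙ qpow (A ℕ.+ E)     ∎

  ⊙-⊗-⊗ : ∀ c f g h → c ⊙ ((f ⊗ g) ⊗ h) ≈ (c ⊙ f) * g * h
  ⊙-⊗-⊗ c f g h = begin
    c ⊙ ((f ⊗ g) ⊗ h)  ≈⟨ ⊙-⊗-assoc c (f ⊗ g) h ⟨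
    (c ⊙ (f ⊗ g)) ⊗ h  ≈⟨ ⊗-cong {g = h} (⊙-⊗-assoc c f g) (λ _ → ≡.refl) ⟨
    ((c ⊙ f) ⊗ g) ⊗ h  ≈⟨ ⊗≗*ₛ ((c ⊙ f) ⊗ g) h ⟩
    ((c ⊙ f) ⊗ g) * h  ≈⟨ *-congʳ (⊗≗*ₛ (c ⊙ f) g) ⟩
    (c ⊙ f) * g * h    ∎

module _ where
  open CommutativeRing seriesRing
  open SumToProperties +-commutativeMonoid

  sumTo-⊕ : ∀ F k → sumTo _⊕_ zeroS F k ≈ sumTo _+_ 0# F k
  sumTo-⊕ F zero    = refl
  sumTo-⊕ F (suc k) = trans (⊕≗+ₛ _ (F (suc k))) (+-congʳ (sumTo-⊕ F k))

  if-≡ᵇ-yes : ∀ {m n} (X : Series) → m ≡ n → (if m ℕ.≡ᵇ n then X else zeroS) ≈ X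
  if-≡ᵇ-yes {m} {n} X m≡n = reflexive (≡.cong (λ b → if b then X else zeroS) (dec-true (m ℕ.≟ n) m≡n))

  if-≡ᵇ-no : ∀ {m n} (X : Series) → m ≢ n → (if m ℕ.≡ᵇ n then X else zeroS) ≈ 0#
  if-≡ᵇ-no {m} {n} X m≢n = reflexive (≡.cong (λ b → if b then X else zeroS) (dec-false (m ℕ.≟ n) m≢n))

  doubleSumX-antidiagonal : ∀ T k → doubleSumX T k ≈ sumTo _+_ 0# (λ i → T i (k ∸ i)) k
  doubleSumX-antidiagonal T k = trans (sumTo-⊕ _ k) (sumTo-cong k (λ i i≤k →
    trans (sumTo-⊕ _ k) (trans
      (sumTo-single _ k (k ∸ i) (ℕ.m∸n≤m k i) (λ j _ j≢k-i → if-≡ᵇ-no (T i j)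
        (λ i+j≡k → j≢k-i (≡.trans (≡.sym (ℕ.m+n∸m≡n i j)) (≡.cong (_∸ i) i+j≡k)))))
      (if-≡ᵇ-yes (T i (k ∸ i)) (ℕ.m+[n∸m]≡n i≤k)))))

  singleSumX2-even : ∀ S n → singleSumX2 S (2 ℕ.* n) ≈ S n
  singleSumX2-even S n = trans (sumTo-⊕ _ (2 ℕ.* n)) (trans
    (sumTo-single _ (2 ℕ.* n) n (ℕ.m≤n*m n 2) (λ m _ m≢n → if-≡ᵇ-no (S m) (m≢n ∘ ℕ.*-cancelˡ-≡ m n 2)))
    (if-≡ᵇ-yes {2 ℕ.* n} (S n) ≡.refl))

  singleSumX2-odd : ∀ S n → singleSumX2 S (suc (2 ℕ.* n)) ≈ 0#
  singleSumX2-odd S n = trans (sumTo-⊕ _ (suc (2 ℕ.* n)))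
    (sumTo-zero _ (suc (2 ℕ.* n)) (λ m _ → if-≡ᵇ-no (S m) (ℕ.even≢odd m n)))

even-or-odd : ∀ k → (∃[ n ] k ≡ 2 ℕ.* n) ⊎ (∃[ n ] k ≡ suc (2 ℕ.* n))
even-or-odd zero = inj₁ (0 , ≡.refl)
even-or-odd (suc k) with even-or-odd k
... | inj₁ (n , ≡.refl) = inj₂ (n , ≡.refl)
... | inj₂ (n , ≡.refl) = inj₁ (suc n , ≡.cong suc (≡.sym (ℕ.+-suc n (n ℕ.+ 0))))

module DoubleSumIdentity (a b : ℕ) .{{_ : NonZero a}} (sign : ℕ → ℕ → ℤ) (E : ℕ → ℕ → ℕ) where
  open CommutativeRing seriesRing
  open RawSemiringDefinitions (Semiring.rawSemiring semiring) using (_^_)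
  open import Algebra.Properties.CommutativeSemigroup *-commutativeSemigroup using (x∙yz≈y∙xz)
  open import Relation.Binary.Reasoning.Setoid setoid
  open SumToProperties +-commutativeMonoid

  1-qpow^≈1-qpow : ∀ m → 1# - qpow a ^ m ≈ 1# - qpow (a ℕ.* m)
  1-qpow^≈1-qpow m = +-congˡ (-‿cong (qpow-^ a m))

  invPoch-recurrence : PochhammerRecurrence seriesRing (qpow a) (invPoch a)
  invPoch-recurrence i = trans (*-congʳ (1-qpow^≈1-qpow (suc i))) (invPoch-rec a i)

  open DiagonalSums seriesRing (qpow a) (invPoch a) invPoch-recurrence public

  lhs : ℕ → ℕ → Series
  lhs i j = sign i j ⊙ ((qpow (E i j) ⊗ invPoch a i) ⊗ invPoch a j)

  weight : ℕ → ℕ → Series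
  weight i j = monomial (sign i j) (E i j)

  rhs : ℕ → Series
  rhs n = qpow (b ℕ.* n ℕ.* n) ⊗ invPoch (2 ℕ.* a) n

  1-qpow^-cancel : ∀ m {f g} → (1# - qpow a ^ suc m) * f ≈ (1# - qpow a ^ suc m) * g → f ≈ g
  1-qpow^-cancel m f≈g = 1-qpow-cancel (a ℕ.* suc m) {{ℕ.m*n≢0 a (suc m)}}
    (trans (*-congʳ (sym (1-qpow^≈1-qpow _))) (trans f≈g (*-congʳ (1-qpow^≈1-qpow _))))

  rhs-rec : ∀ n → (1# - qpow a ^ (2 ℕ.+ 2 ℕ.* n)) * rhs (suc n) ≈ qpow (b ℕ.* suc (2 ℕ.* n)) * rhs n
  rhs-rec n = begin
    (1# - qpow a ^ (2 ℕ.+ 2 ℕ.* n)) * rhs (suc n)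
      ≈⟨ *-cong (trans (1-qpow^≈1-qpow _) (+-congˡ (-‿cong (reflexive (≡.cong qpow (double a n))))))
                (⊗≗*ₛ (qpow B) (invPoch (2 ℕ.* a) (suc n))) ⟩
    (1# - qpow (2 ℕ.* a ℕ.* suc n)) * (qpow B * invPoch (2 ℕ.* a) (suc n))
      ≈⟨ x∙yz≈y∙xz _ _ _ ⟩
    qpow B * ((1# - qpow (2 ℕ.* a ℕ.* suc n)) * invPoch (2 ℕ.* a) (suc n))
      ≈⟨ *-congˡ (invPoch-rec (2 ℕ.* a) {{ℕ.m*n≢0 2 a}} n) ⟩
    qpow B * invPoch (2 ℕ.* a) n
      ≈⟨ *-congʳ (trans (reflexive (≡.cong qpow (square b n))) (sym (qpow-*-qpow C D))) ⟩
    qpow C * qpow D * invPoch (2 ℕ.* a) n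
      ≈⟨ *-assoc _ _ _ ⟩
    qpow C * (qpow D * invPoch (2 ℕ.* a) n)
      ≈⟨ *-congˡ (⊗≗*ₛ (qpow D) (invPoch (2 ℕ.* a) n)) ⟨
    qpow C * rhs n ∎
    where
    B C D : ℕ
    B = b ℕ.* suc n ℕ.* suc n
    C = b ℕ.* suc (2 ℕ.* n)
    D = b ℕ.* n ℕ.* n
    double : ∀ a n → a ℕ.* (2 ℕ.+ 2 ℕ.* n) ≡ 2 ℕ.* a ℕ.* suc n
    double = ℕ-solve-∀
    square : ∀ b n → b ℕ.* suc n ℕ.* suc n ≡ b ℕ.* suc (2 ℕ.* n) ℕ.+ b ℕ.* n ℕ.* n
    square = ℕ-solve-∀

  doubleSumX≈diagSum : ∀ k → doubleSumX lhs k ≈ diagSum weight k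
  doubleSumX≈diagSum k = trans (doubleSumX-antidiagonal lhs k) (sumTo-cong k (λ i _ →
    ⊙-⊗-⊗ (sign i (k ∸ i)) (qpow (E i (k ∸ i))) (invPoch a i) (invPoch a (k ∸ i))))

  diagSum-0 : weight 0 0 ≈ 1# → diagSum weight 0 ≈ rhs 0
  diagSum-0 weight₀₀≈1 = begin
    weight 0 0 * 1# * 1#       ≈⟨ trans (*-identityʳ _) (*-identityʳ _) ⟩
    weight 0 0                 ≈⟨ weight₀₀≈1 ⟩
    1#                         ≈⟨ qpow-0 ⟨
    qpow 0                     ≈⟨ reflexive (≡.cong qpow (ℕ.*-zeroʳ (b ℕ.* 0))) ⟨
    qpow (b ℕ.* 0 ℕ.* 0)       ≈⟨ *-identityʳ _ ⟨
    qpow (b ℕ.* 0 ℕ.* 0) * 1#  ≈⟨ ⊗≗*ₛ _ oneS ⟨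
    rhs 0                      ∎

  diagSum-1 : weight 0 1 ≈ - weight 1 0 → diagSum weight 1 ≈ 0#
  diagSum-1 weight₀₁≈-weight₁₀ = begin
    weight 0 1 * 1# * P₁ + weight 1 0 * P₁ * 1#  ≈⟨ +-cong (*-congʳ (*-identityʳ _)) (*-identityʳ _) ⟩
    weight 0 1 * P₁ + weight 1 0 * P₁            ≈⟨ distribʳ P₁ _ _ ⟨
    (weight 0 1 + weight 1 0) * P₁
      ≈⟨ *-congʳ (trans (+-congʳ weight₀₁≈-weight₁₀) (-‿inverseˡ _)) ⟩
    0# * P₁                                      ≈⟨ zeroˡ P₁ ⟩
    0#                                           ∎
    where
    P₁ : Series
    P₁ = invPoch a 1

  module _ (weight-rec : ∀ k → (1# - qpow a ^ (2 ℕ.+ k)) * diagSum weight (2 ℕ.+ k)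
                               ≈ qpow (b ℕ.* suc k) * diagSum weight k)
           (weight₀₀≈1 : weight 0 0 ≈ 1#) (weight₀₁≈-weight₁₀ : weight 0 1 ≈ - weight 1 0) where

    diagSum-even-odd : ∀ n → diagSum weight (2 ℕ.* n) ≈ rhs n × diagSum weight (suc (2 ℕ.* n)) ≈ 0#
    diagSum-even-odd = even-odd-from-recurrence semiring
      (λ m → 1# - qpow a ^ (2 ℕ.+ m)) (λ m → qpow (b ℕ.* suc m)) (diagSum weight) rhs
      (λ m → 1-qpow^-cancel (suc m)) weight-rec rhs-rec (diagSum-0 weight₀₀≈1) (diagSum-1 weight₀₁≈-weight₁₀)

    doubleSumX≈singleSumX2 : ∀ k → doubleSumX lhs k ≈ singleSumX2 rhs k
    doubleSumX≈singleSumX2 k with even-or-odd k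
    ... | inj₁ (n , ≡.refl) =
      trans (doubleSumX≈diagSum k) (trans (proj₁ (diagSum-even-odd n)) (sym (singleSumX2-even rhs n)))
    ... | inj₂ (n , ≡.refl) =
      trans (doubleSumX≈diagSum k) (trans (proj₂ (diagSum-even-odd n)) (sym (singleSumX2-odd rhs n)))

-- Signs

module _ where
  open ≡ using (refl; sym; trans; cong; cong₂)
  open ≡.≡-Reasoning

  signZ-suc : ∀ n → signZ (+ suc n) ≡ ℤ.- signZ (+ n)
  signZ-suc 0             = refl
  signZ-suc 1             = refl
  signZ-suc (suc (suc n)) = signZ-suc n

  signZ-+ : ∀ m n → signZ (+ (m ℕ.+ n)) ≡ signZ (+ m) ℤ.* signZ (+ n)
  signZ-+ zero    n = sym (ℤ.*-identityˡ (signZ (+ n)))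
  signZ-+ (suc m) n = begin
    signZ (+ suc (m ℕ.+ n))            ≡⟨ signZ-suc (m ℕ.+ n) ⟩
    ℤ.- signZ (+ (m ℕ.+ n))            ≡⟨ cong ℤ.-_ (signZ-+ m n) ⟩
    ℤ.- (signZ (+ m) ℤ.* signZ (+ n))  ≡⟨ ℤ.neg-distribˡ-* (signZ (+ m)) (signZ (+ n)) ⟩
    ℤ.- signZ (+ m) ℤ.* signZ (+ n)    ≡⟨ cong (ℤ._* signZ (+ n)) (signZ-suc m) ⟨
    signZ (+ suc m) ℤ.* signZ (+ n)    ∎

  signZ-square : ∀ n → signZ (+ n) ℤ.* signZ (+ n) ≡ + 1
  signZ-square zero    = refl
  signZ-square (suc n) =
    trans (cong₂ ℤ._*_ (signZ-suc n) (signZ-suc n)) (trans (neg*neg (signZ (+ n))) (signZ-square n))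
    where
    neg*neg : ∀ s → ℤ.- s ℤ.* ℤ.- s ≡ s ℤ.* s
    neg*neg = solve-∀

  triangle : ℕ → ℕ
  triangle zero    = zero
  triangle (suc n) = suc n ℕ.+ triangle n

  triangle-*2 : ∀ n → triangle n ℕ.* 2 ≡ suc n ℕ.* n
  triangle-*2 zero    = refl
  triangle-*2 (suc n) = begin
    (suc n ℕ.+ triangle n) ℕ.* 2      ≡⟨ ℕ.*-distribʳ-+ 2 (suc n) (triangle n) ⟩
    suc n ℕ.* 2 ℕ.+ triangle n ℕ.* 2  ≡⟨ cong (suc n ℕ.* 2 ℕ.+_) (triangle-*2 n) ⟩
    suc n ℕ.* 2 ℕ.+ suc n ℕ.* n       ≡⟨ ℕ.*-distribˡ-+ (suc n) 2 n ⟨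
    suc n ℕ.* (2 ℕ.+ n)               ≡⟨ ℕ.*-comm (suc n) (2 ℕ.+ n) ⟩
    suc (suc n) ℕ.* suc n             ∎

  -- triangle (2 + n) - triangle n = 2n + 3 is odd
  signZ-triangle : ∀ n → signZ (+ triangle (2 ℕ.+ n)) ≡ ℤ.- signZ (+ triangle n)
  signZ-triangle n = begin
    signZ (+ (n ℕ.+ (suc n ℕ.+ triangle n)))  ≡⟨ signZ-+ n (suc n ℕ.+ triangle n) ⟩
    s n ℤ.* signZ (+ suc (n ℕ.+ triangle n))   ≡⟨ cong (s n ℤ.*_) (signZ-suc (n ℕ.+ triangle n)) ⟩
    s n ℤ.* ℤ.- signZ (+ (n ℕ.+ triangle n))   ≡⟨ cong (λ z → s n ℤ.* ℤ.- z) (signZ-+ n (triangle n)) ⟩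
    s n ℤ.* ℤ.- (s n ℤ.* s (triangle n))       ≡⟨ regroup (s n) (s (triangle n)) ⟩
    ℤ.- (s n ℤ.* s n ℤ.* s (triangle n))       ≡⟨ cong (λ z → ℤ.- (z ℤ.* s (triangle n))) (signZ-square n) ⟩
    ℤ.- (+ 1 ℤ.* s (triangle n))               ≡⟨ cong ℤ.-_ (ℤ.*-identityˡ (s (triangle n))) ⟩
    ℤ.- s (triangle n)                         ∎
    where
    s : ℕ → ℤ
    s m = signZ (+ m)
    regroup : ∀ x y → x ℤ.* ℤ.- (x ℤ.* y) ≡ ℤ.- (x ℤ.* x ℤ.* y)
    regroup = solve-∀

  binom2-suc : ∀ n → binom2 (+ suc n) ≡ + triangle n
  binom2-suc n = cong +_ (begin
    ℤ.∣ + suc n ℤ.* + n ∣ ℕ./ 2  ≡⟨ cong (ℕ._/ 2) (ℤ.abs-* (+ suc n) (+ n)) ⟩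
    suc n ℕ.* n ℕ./ 2            ≡⟨ cong (ℕ._/ 2) (triangle-*2 n) ⟨
    triangle n ℕ.* 2 ℕ./ 2       ≡⟨ m*n/n≡m (triangle n) 2 ⟩
    triangle n                   ∎)

  -- -[1+ n ] - 1 computes to -[1+ suc (n + 0) ]
  binom2-neg : ∀ n → binom2 -[1+ n ] ≡ + triangle (suc n)
  binom2-neg n = cong +_ (begin
    ℤ.∣ -[1+ n ] ℤ.* -[1+ suc (n ℕ.+ 0) ] ∣ ℕ./ 2
      ≡⟨ cong (ℕ._/ 2) (ℤ.abs-* -[1+ n ] -[1+ suc (n ℕ.+ 0) ]) ⟩
    suc n ℕ.* suc (suc (n ℕ.+ 0)) ℕ./ 2
      ≡⟨ cong (ℕ._/ 2) (commute n) ⟩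
    suc (suc n) ℕ.* suc n ℕ./ 2
      ≡⟨ cong (ℕ._/ 2) (triangle-*2 (suc n)) ⟨
    triangle (suc n) ℕ.* 2 ℕ./ 2
      ≡⟨ m*n/n≡m (triangle (suc n)) 2 ⟩
    triangle (suc n) ∎)
    where
    commute : ∀ n → suc n ℕ.* suc (suc (n ℕ.+ 0)) ≡ suc (suc n) ℕ.* suc n
    commute = ℕ-solve-∀

  -- binom(d + 1, 2) - binom(d - 1, 2) = 2d - 1 is odd
  signZ-binom2-flip : ∀ d → signZ (binom2 (d ℤ.- + 1)) ≡ ℤ.- signZ (binom2 (d ℤ.+ + 1))
  signZ-binom2-flip (+ zero)        = refl
  signZ-binom2-flip (+ suc zero)    = refl
  signZ-binom2-flip (+ suc (suc m)) = begin
    signZ (binom2 (+ suc m))                    ≡⟨ cong signZ (binom2-suc m) ⟩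
    signZ (+ triangle m)                        ≡⟨ ℤ.neg-involutive (signZ (+ triangle m)) ⟨
    ℤ.- ℤ.- signZ (+ triangle m)                ≡⟨ cong ℤ.-_ (signZ-triangle m) ⟨
    ℤ.- signZ (+ triangle (2 ℕ.+ m))            ≡⟨ cong (ℤ.-_ ∘ signZ) (binom2-suc (2 ℕ.+ m)) ⟨
    ℤ.- signZ (binom2 (+ suc (suc (suc m))))
      ≡⟨ cong (λ n → ℤ.- signZ (binom2 (+ suc (suc n)))) (ℕ.+-comm 1 m) ⟩
    ℤ.- signZ (binom2 (+ suc (suc (m ℕ.+ 1))))  ∎
  signZ-binom2-flip -[1+ zero ]     = refl
  signZ-binom2-flip -[1+ suc m ]    = begin
    signZ (binom2 -[1+ suc (suc (m ℕ.+ 0)) ])  ≡⟨ cong signZ (binom2-neg (suc (suc (m ℕ.+ 0)))) ⟩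
    signZ (+ triangle (2 ℕ.+ suc (m ℕ.+ 0)))
      ≡⟨ cong (λ n → signZ (+ triangle (2 ℕ.+ suc n))) (ℕ.+-identityʳ m) ⟩
    signZ (+ triangle (2 ℕ.+ suc m))           ≡⟨ signZ-triangle (suc m) ⟩
    ℤ.- signZ (+ triangle (suc m))             ≡⟨ cong (ℤ.-_ ∘ signZ) (binom2-neg m) ⟨
    ℤ.- signZ (binom2 -[1+ m ])                ∎

-- The two identities

sign₁ sign₂ : ℕ → ℕ → ℤ
sign₁ _ j = signZ (+ j)
sign₂ i j = signZ (binom2 (+ i ℤ.- + j))

E₁ E₂ : ℕ → ℕ → ℕ
E₁ i j = i ℕ.* i ℕ.+ 2 ℕ.* i ℕ.* j ℕ.+ j ℕ.* j
E₂ i j = 3 ℕ.* i ℕ.* i ℕ.+ 2 ℕ.* i ℕ.* j ℕ.+ 3 ℕ.* j ℕ.* j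

module _ where
  open import Data.Nat using (_+_; _*_)

  E₁-skew : ∀ i j → i * i + 2 * i * (1 + j) + (1 + j) * (1 + j) ≡ (1 + i) * (1 + i) + 2 * (1 + i) * j + j * j
  E₁-skew = ℕ-solve-∀

  E₁-diagonal : ∀ i j → (1 + i) * (1 + i) + 2 * (1 + i) * (1 + j) + (1 + j) * (1 + j)
                        ≡ 4 * (1 + (i + j)) + (i * i + 2 * i * j + j * j)
  E₁-diagonal = ℕ-solve-∀

  E₂-twisted : ∀ i j → 4 * i + (3 * i * i + 2 * i * (1 + j) + 3 * (1 + j) * (1 + j))
                       ≡ 4 * j + (3 * (1 + i) * (1 + i) + 2 * (1 + i) * j + 3 * j * j)
  E₂-twisted = ℕ-solve-∀

  E₂-diagonal : ∀ i j → 3 * (1 + i) * (1 + i) + 2 * (1 + i) * (1 + j) + 3 * (1 + j) * (1 + j)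
                        ≡ 8 * (1 + (i + j)) + (3 * i * i + 2 * i * j + 3 * j * j)
  E₂-diagonal = ℕ-solve-∀

sign₂-flip : ∀ i j → sign₂ i (suc j) ≡ ℤ.- sign₂ (suc i) j
sign₂-flip i j = ≡.trans (≡.cong (signZ ∘ binom2) (lower (+ i) (+ j)))
  (≡.trans (signZ-binom2-flip (+ i ℤ.- + j)) (≡.cong (ℤ.-_ ∘ signZ ∘ binom2) (raise (+ i) (+ j))))
  where
  lower : ∀ x y → x ℤ.- (+ 1 ℤ.+ y) ≡ (x ℤ.- y) ℤ.- + 1
  lower = solve-∀
  raise : ∀ x y → (x ℤ.- y) ℤ.+ + 1 ≡ (+ 1 ℤ.+ x) ℤ.- y
  raise = solve-∀

sign₂-suc-suc : ∀ i j → sign₂ (suc i) (suc j) ≡ sign₂ i j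
sign₂-suc-suc i j = ≡.cong (signZ ∘ binom2) (cancel (+ i) (+ j))
  where
  cancel : ∀ x y → (+ 1 ℤ.+ x) ℤ.- (+ 1 ℤ.+ y) ≡ x ℤ.- y
  cancel = solve-∀

module Identity₁ where
  open DoubleSumIdentity 8 4 sign₁ E₁
  open CommutativeRing seriesRing
  open import Relation.Binary.Reasoning.Setoid setoid

  weight₀₀≈1 : weight 0 0 ≈ 1#
  weight₀₀≈1 zero    = ≡.refl
  weight₀₀≈1 (suc _) = ≡.refl

  skew : ∀ i j → weight i (suc j) ≈ - weight (suc i) j
  skew i j = trans (reflexive (≡.cong₂ monomial (signZ-suc j) (E₁-skew i j)))
                   (monomial-neg (signZ (+ j)) (E₁ (suc i) j))

  diagonal : ∀ k i j → i ℕ.+ j ≡ k → weight (suc i) (suc j) ≈ - (qpow (4 ℕ.* suc k) * weight i j)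
  diagonal k i j ≡.refl = begin
    weight (suc i) (suc j)                     ≈⟨ reflexive (≡.cong₂ monomial (signZ-suc j) (E₁-diagonal i j)) ⟩
    monomial (ℤ.- signZ (+ j)) (A ℕ.+ E₁ i j)  ≈⟨ monomial-neg (signZ (+ j)) (A ℕ.+ E₁ i j) ⟩
    - monomial (signZ (+ j)) (A ℕ.+ E₁ i j)    ≈⟨ -‿cong (qpow-*-monomial A (signZ (+ j)) (E₁ i j)) ⟨
    - (qpow A * weight i j)                    ∎
    where
    A : ℕ
    A = 4 ℕ.* suc (i ℕ.+ j)

  identity : ∀ k → doubleSumX lhs1 k ≈ singleSumX2 rhs1 k
  identity = doubleSumX≈singleSumX2
    (λ k → diagSum-skew-recurrence weight skew (qpow (4 ℕ.* suc k)) k (diagonal k))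
    weight₀₀≈1 (skew 0 0)

module Identity₂ where
  open DoubleSumIdentity 4 8 sign₂ E₂
  open CommutativeRing seriesRing
  open RawSemiringDefinitions (Semiring.rawSemiring semiring) using (_^_)
  open import Relation.Binary.Reasoning.Setoid setoid

  weight₀₀≈1 : weight 0 0 ≈ 1#
  weight₀₀≈1 zero    = ≡.refl
  weight₀₀≈1 (suc _) = ≡.refl

  twisted : ∀ i j → qpow 4 ^ i * weight i (suc j) ≈ - (qpow 4 ^ j * weight (suc i) j)
  twisted i j = begin
    qpow 4 ^ i * weight i (suc j)
      ≈⟨ *-congʳ (qpow-^ 4 i) ⟩
    qpow (4 ℕ.* i) * weight i (suc j)
      ≈⟨ qpow-*-monomial (4 ℕ.* i) (sign₂ i (suc j)) (E₂ i (suc j)) ⟩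
    monomial (sign₂ i (suc j)) (4 ℕ.* i ℕ.+ E₂ i (suc j))
      ≈⟨ reflexive (≡.cong₂ monomial (sign₂-flip i j) (E₂-twisted i j)) ⟩
    monomial (ℤ.- sign₂ (suc i) j) (4 ℕ.* j ℕ.+ E₂ (suc i) j)
      ≈⟨ monomial-neg (sign₂ (suc i) j) (4 ℕ.* j ℕ.+ E₂ (suc i) j) ⟩
    - monomial (sign₂ (suc i) j) (4 ℕ.* j ℕ.+ E₂ (suc i) j)
      ≈⟨ -‿cong (qpow-*-monomial (4 ℕ.* j) (sign₂ (suc i) j) (E₂ (suc i) j)) ⟨
    - (qpow (4 ℕ.* j) * weight (suc i) j)
      ≈⟨ -‿cong (*-congʳ (qpow-^ 4 j)) ⟨
    - (qpow 4 ^ j * weight (suc i) j) ∎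

  diagonal : ∀ k i j → i ℕ.+ j ≡ k → weight (suc i) (suc j) ≈ qpow (8 ℕ.* suc k) * weight i j
  diagonal k i j ≡.refl = begin
    weight (suc i) (suc j)               ≈⟨ reflexive (≡.cong₂ monomial (sign₂-suc-suc i j) (E₂-diagonal i j)) ⟩
    monomial (sign₂ i j) (A ℕ.+ E₂ i j)  ≈⟨ qpow-*-monomial A (sign₂ i j) (E₂ i j) ⟨
    qpow A * weight i j                  ∎
    where
    A : ℕ
    A = 8 ℕ.* suc (i ℕ.+ j)

  identity : ∀ k → doubleSumX lhs2 k ≈ singleSumX2 rhs2 k
  identity = doubleSumX≈singleSumX2
    (λ k → diagSum-twisted-recurrence weight twisted (qpow (8 ℕ.* suc k)) k (diagonal k))
    weight₀₀≈1 (monomial-neg (+ 1) 3)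

theorem1p5 : ((k N : ℕ) → doubleSumX lhs1 k N ≡ singleSumX2 rhs1 k N)
             × ((k N : ℕ) → doubleSumX lhs2 k N ≡ singleSumX2 rhs2 k N)
theorem1p5 = Identity₁.identity , Identity₂.identity
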